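{- Let $B\subseteq A$ be rings and $\underline D=(D_1,\dots,D_N)$ a collection of derivations of $A$. Let $D_i'=\sum_{j=1}^Nc_{ij}D_j$ ($i=1,\dots,N$) with $(c_{ij})_{1\le i,j\le N}\in GL_N(B_{\underline D})$, and $\underline D'=(D_1',\dots,D_N')$. Then $B_{\underline D}=B_{\underline D'}$.
   Context: Rings are commutative with unity. A derivation of $A$ is a $\mathbb Z$-linear map $D:A\to A$ with $D(ab)=aD(b)+bD(a)$. For a collection $\underline D$ of derivations, $\mathfrak U(\underline D)$ is the subring of $\mathrm{End}_{\mathbb Z}(A)$ generated by the elements of $\underline D$, and for a subring $B\subseteq A$, $B_{\underline D}=\{b\in B:Db\in B\text{ for all }D\in\mathfrak U(\underline D)\}$ (a subring of $B$). -}

module Defs where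

open import Level using (Level; _⊔_; suc)
open import Algebra.Bundles using (CommutativeRing)
open import Data.Nat using (ℕ)
open import Data.Fin using (Fin)
open import Data.Product using (_×_; Σ)
open import Relation.Unary using (Pred)
open import Function using (id; _∘_)
import Data.Fin
import Relation.Nullary
import Algebra.Definitions.RawMonoid as RawMonoidDefs

module _ {c ℓ : Level} (R : CommutativeRing c ℓ) where
  open CommutativeRing R

  ∑ : {N : ℕ} → (Fin N → Carrier) → Carrier
  ∑ = RawMonoidDefs.sum +-rawMonoid

  record IsSubring {b : Level} (B : Pred Carrier b) : Set (c ⊔ ℓ ⊔ b) where
    field
      resp  : ∀ {x y} → x ≈ y → B x → B y
      has-0 : B 0#
      has-1 : B 1#
      +-closed : ∀ {x y} → B x → B y → B (x + y)
      neg-closed : ∀ {x} → B x → B (- x)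
      *-closed : ∀ {x y} → B x → B y → B (x * y)

  record IsDerivation (D : Carrier → Carrier) : Set (c ⊔ ℓ) where
    field
      cong     : ∀ {x y} → x ≈ y → D x ≈ D y
      additive : ∀ x y → D (x + y) ≈ D x + D y
      leibniz  : ∀ x y → D (x * y) ≈ x * D y + y * D x

  -- 𝔘(D): the subring of End_ℤ(A) (ring structure: pointwise +, composition,
  -- identity) generated by the D i; membership is up to pointwise ≈.
  data 𝔘 {N : ℕ} (D : Fin N → Carrier → Carrier) : Pred (Carrier → Carrier) (c ⊔ ℓ) where
    gen  : ∀ i → 𝔘 D (D i)
    zer  : 𝔘 D (λ _ → 0#)
    one  : 𝔘 D id
    add  : ∀ {f g} → 𝔘 D f → 𝔘 D g → 𝔘 D (λ x → f x + g x)
    neg  : ∀ {f} → 𝔘 D f → 𝔘 D (λ x → - f x)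
    comp : ∀ {f g} → 𝔘 D f → 𝔘 D g → 𝔘 D (f ∘ g)
    ext  : ∀ {f g} → 𝔘 D f → (∀ x → f x ≈ g x) → 𝔘 D g

  _[_] : {b : Level} {N : ℕ} → Pred Carrier b → (Fin N → Carrier → Carrier) → Pred Carrier (c ⊔ ℓ ⊔ b)
  (B [ D ]) x = B x × (∀ (E : Carrier → Carrier) → 𝔘 D E → B (E x))

  Mat : ℕ → Set c
  Mat N = Fin N → Fin N → Carrier

  _⊗_ : {N : ℕ} → Mat N → Mat N → Mat N
  (M ⊗ M') i k = ∑ (λ j → M i j * M' j k)

  δ : {N : ℕ} → Mat N
  δ i j with Data.Fin._≟_ i j
  ... | Relation.Nullary.yes _ = 1#
  ... | Relation.Nullary.no _  = 0#

  InGL : {s : Level} (N : ℕ) → Pred Carrier s → Pred (Mat N) (c ⊔ ℓ ⊔ s)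
  InGL N S C = (∀ i j → S (C i j)) ×
    Σ (Mat N) (λ C⁻¹ → (∀ i j → S (C⁻¹ i j))
                     × (∀ i j → (C ⊗ C⁻¹) i j ≈ δ i j)
                     × (∀ i j → (C⁻¹ ⊗ C) i j ≈ δ i j))

  transform : {N : ℕ} → Mat N → (Fin N → Carrier → Carrier) → Fin N → Carrier → Carrier
  transform C D i x = ∑ (λ j → C i j * D j x)

module Submission where

-- The key tool is a stability principle: a predicate K ⊆ B that respects ≈,
-- contains 0, is closed under +, - and under every generator E_i is closed
-- under all of 𝔘(E), hence K ⊆ B_E.  Applied to the subring generated by B_E
-- (which is stable under each derivation E_i by the Leibniz rule) it shows
-- that B_E is itself a subring of A, closed under every E_i.
-- Consequently, if C has entries in B_E, then B_E is stable under each
-- (CE)_i = Σ_j c_ij E_j, so B_E ⊆ B_{CE}.  For C ∈ GL_N(B_D) with inverse C⁻¹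
-- this gives B_D ⊆ B_{CD}; the entries of C⁻¹ then lie in B_{CD}, so also
-- B_{CD} ⊆ B_{C⁻¹(CD)}, and C⁻¹(CD) agrees with D pointwise, which gives
-- 𝔘(D) ⊆ 𝔘(C⁻¹(CD)) and hence B_{C⁻¹(CD)} ⊆ B_D.

open import Defs
open import Level using (Level; _⊔_)
open import Algebra.Bundles using (CommutativeRing)
open import Data.Nat using (ℕ; zero; suc)
open import Data.Fin using (Fin; punchIn; _≟_)
import Data.Fin as Fin
open import Data.Fin.Properties using (punchInᵢ≢i)
open import Relation.Unary using (Pred; _⊆_)
open import Data.Product using (_×_; _,_; proj₁)
open import Function using (_∘_)
open import Relation.Nullary using (yes; no)
open import Data.Empty using (⊥-elim)
open import Relation.Binary.PropositionalEquality as ≡ using (_≢_)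
import Algebra.Properties.Semiring.Sum as SumProperties
import Algebra.Properties.AbelianGroup as AbelianGroupProperties
import Algebra.Properties.Ring as RingProperties
import Relation.Binary.Reasoning.Setoid as SetoidReasoning

module Development {c ℓ : Level} (R : CommutativeRing c ℓ) where
  open CommutativeRing R hiding (zero)
  open SumProperties semiring
    using (sum-cong-≋; sum-remove; sum-replicate-zero; ∑-distrib-+; ∑-comm; *-distribˡ-sum; *-distribʳ-sum)
  open AbelianGroupProperties +-abelianGroup using (inverseʳ-unique)
  open RingProperties ring using (x+x≈x⇒x≈0)
  open SetoidReasoning setoid

  module DerivationFacts {D : Carrier → Carrier} (isD : IsDerivation R D) where
    open IsDerivation isD renaming (cong to D-cong)

    D-0 : D 0# ≈ 0#
    D-0 = x+x≈x⇒x≈0 (D 0#) (begin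
      D 0# + D 0#  ≈⟨ additive 0# 0# ⟨
      D (0# + 0#)  ≈⟨ D-cong (+-identityˡ 0#) ⟩
      D 0#         ∎)

    D-1 : D 1# ≈ 0#
    D-1 = x+x≈x⇒x≈0 (D 1#) (begin
      D 1# + D 1#            ≈⟨ +-cong (*-identityˡ _) (*-identityˡ _) ⟨
      1# * D 1# + 1# * D 1#  ≈⟨ leibniz 1# 1# ⟨
      D (1# * 1#)            ≈⟨ D-cong (*-identityˡ 1#) ⟩
      D 1#                   ∎)

    D-neg : ∀ x → D (- x) ≈ - D x
    D-neg x = inverseʳ-unique (D x) (D (- x)) (begin
      D x + D (- x)  ≈⟨ additive x (- x) ⟨
      D (x + - x)    ≈⟨ D-cong (-‿inverseʳ x) ⟩
      D 0#           ≈⟨ D-0 ⟩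
      0#             ∎)

  δ-diagonal : ∀ {n} (j : Fin n) → δ R j j ≈ 1#
  δ-diagonal j with j ≟ j
  ... | yes _ = refl
  ... | no j≢j = ⊥-elim (j≢j ≡.refl)

  δ-off-diagonal : ∀ {n} (j k : Fin n) → j ≢ k → δ R j k ≈ 0#
  δ-off-diagonal j k j≢k with j ≟ k
  ... | yes j≡k = ⊥-elim (j≢k j≡k)
  ... | no _ = refl


  ∑-δ : ∀ {n} (j : Fin n) (g : Fin n → Carrier) → ∑ R (λ k → δ R j k * g k) ≈ g j
  ∑-δ {suc n} j g = begin
    ∑ R f                                ≈⟨ sum-remove {i = j} f ⟩
    f j + ∑ R (λ k → f (punchIn j k))    ≈⟨ +-congˡ others-vanish ⟩
    f j + 0#                             ≈⟨ +-identityʳ (f j) ⟩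
    δ R j j * g j                        ≈⟨ *-congʳ (δ-diagonal j) ⟩
    1# * g j                             ≈⟨ *-identityˡ (g j) ⟩
    g j                                  ∎
    where
    f : Fin (suc n) → Carrier
    f k = δ R j k * g k

    others-vanish : ∑ R (λ k → f (punchIn j k)) ≈ 0#
    others-vanish = trans
      (sum-cong-≋ (λ k → trans (*-congʳ (δ-off-diagonal j _ (punchInᵢ≢i j k ∘ ≡.sym))) (zeroˡ _)))
      (sum-replicate-zero n)

  -- A predicate is 𝔘(E)-stable if it respects ≈, contains 0, and is closed
  -- under +, - and every generator E_i; these are the closure conditions
  -- matching the constructors of 𝔘(E).
  record Stable {N : ℕ} {k : Level} (E : Fin N → Carrier → Carrier) (K : Pred Carrier k)
         : Set (c ⊔ ℓ ⊔ k) where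
    field
      respects : ∀ {x y} → x ≈ y → K x → K y
      has-0    : K 0#
      +-closed : ∀ {x y} → K x → K y → K (x + y)
      -‿closed : ∀ {x} → K x → K (- x)
      E-closed : ∀ i {x} → K x → K (E i x)

  𝔘-preserves : ∀ {N k} {E : Fin N → Carrier → Carrier} {K : Pred Carrier k} → Stable E K →
                ∀ {F x} → 𝔘 R E F → K x → K (F x)
  𝔘-preserves st (gen i)    kx = Stable.E-closed st i kx
  𝔘-preserves st zer        kx = Stable.has-0 st
  𝔘-preserves st one        kx = kx
  𝔘-preserves st (add u v)  kx = Stable.+-closed st (𝔘-preserves st u kx) (𝔘-preserves st v kx)
  𝔘-preserves st (neg u)    kx = Stable.-‿closed st (𝔘-preserves st u kx)
  𝔘-preserves st (comp u v) kx = 𝔘-preserves st u (𝔘-preserves st v kx)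
  𝔘-preserves st {x = x} (ext u F≈G) kx = Stable.respects st (F≈G x) (𝔘-preserves st u kx)

  𝔘-mono : ∀ {N} {E E' : Fin N → Carrier → Carrier} → (∀ i → 𝔘 R E' (E i)) →
           ∀ {F} → 𝔘 R E F → 𝔘 R E' F
  𝔘-mono E⊆ (gen i)    = E⊆ i
  𝔘-mono E⊆ zer        = zer
  𝔘-mono E⊆ one        = one
  𝔘-mono E⊆ (add u v)  = add (𝔘-mono E⊆ u) (𝔘-mono E⊆ v)
  𝔘-mono E⊆ (neg u)    = neg (𝔘-mono E⊆ u)
  𝔘-mono E⊆ (comp u v) = comp (𝔘-mono E⊆ u) (𝔘-mono E⊆ v)
  𝔘-mono E⊆ (ext u eq) = ext (𝔘-mono E⊆ u) eq

  transform-derivation : ∀ {N} (C : Mat R N) (E : Fin N → Carrier → Carrier) →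
                         (∀ i → IsDerivation R (E i)) → ∀ i → IsDerivation R (transform R C E i)
  transform-derivation C E isE i = record
    { cong     = λ x≈y → sum-cong-≋ (λ j → *-congˡ (IsDerivation.cong (isE j) x≈y))
    ; additive = additive
    ; leibniz  = leibniz
    }
    where
    E′ = transform R C E i

    additive : ∀ x y → E′ (x + y) ≈ E′ x + E′ y
    additive x y = begin
      ∑ R (λ j → C i j * E j (x + y))
        ≈⟨ sum-cong-≋ (λ j → trans (*-congˡ (IsDerivation.additive (isE j) x y)) (distribˡ _ _ _)) ⟩
      ∑ R (λ j → C i j * E j x + C i j * E j y)
        ≈⟨ ∑-distrib-+ (λ j → C i j * E j x) (λ j → C i j * E j y) ⟩
      E′ x + E′ y ∎

    swap : ∀ a x d → a * (x * d) ≈ x * (a * d)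
    swap a x d = trans (sym (*-assoc a x d)) (trans (*-congʳ (*-comm a x)) (*-assoc x a d))

    leibniz : ∀ x y → E′ (x * y) ≈ x * E′ y + y * E′ x
    leibniz x y = begin
      ∑ R (λ j → C i j * E j (x * y))
        ≈⟨ sum-cong-≋ (λ j → trans (*-congˡ (IsDerivation.leibniz (isE j) x y))
                             (trans (distribˡ _ _ _) (+-cong (swap _ x _) (swap _ y _)))) ⟩
      ∑ R (λ j → x * (C i j * E j y) + y * (C i j * E j x))
        ≈⟨ ∑-distrib-+ (λ j → x * (C i j * E j y)) (λ j → y * (C i j * E j x)) ⟩
      ∑ R (λ j → x * (C i j * E j y)) + ∑ R (λ j → y * (C i j * E j x))
        ≈⟨ +-cong (*-distribˡ-sum x (λ j → C i j * E j y)) (*-distribˡ-sum y (λ j → C i j * E j x)) ⟨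
      x * E′ y + y * E′ x ∎

  transform-⊗ : ∀ {N} (C' C : Mat R N) (E : Fin N → Carrier → Carrier) j z →
                transform R C' (transform R C E) j z ≈ transform R (_⊗_ R C' C) E j z
  transform-⊗ C' C E j z = begin
    ∑ R (λ i → C' j i * ∑ R (λ k → C i k * E k z))
      ≈⟨ sum-cong-≋ (λ i → *-distribˡ-sum (C' j i) (λ k → C i k * E k z)) ⟩
    ∑ R (λ i → ∑ R (λ k → C' j i * (C i k * E k z)))
      ≈⟨ ∑-comm (λ i k → C' j i * (C i k * E k z)) ⟩
    ∑ R (λ k → ∑ R (λ i → C' j i * (C i k * E k z)))
      ≈⟨ sum-cong-≋ (λ k → sum-cong-≋ (λ i → *-assoc (C' j i) (C i k) (E k z))) ⟨
    ∑ R (λ k → ∑ R (λ i → C' j i * C i k * E k z))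
      ≈⟨ sum-cong-≋ (λ k → *-distribʳ-sum (E k z) (λ i → C' j i * C i k)) ⟨
    ∑ R (λ k → _⊗_ R C' C j k * E k z) ∎

  transform-inverse : ∀ {N} (C' C : Mat R N) (E : Fin N → Carrier → Carrier) →
                      (∀ i j → _⊗_ R C' C i j ≈ δ R i j) →
                      ∀ j z → transform R C' (transform R C E) j z ≈ E j z
  transform-inverse C' C E C'C≈I j z = begin
    transform R C' (transform R C E) j z  ≈⟨ transform-⊗ C' C E j z ⟩
    ∑ R (λ k → _⊗_ R C' C j k * E k z)    ≈⟨ sum-cong-≋ (λ k → *-congʳ (C'C≈I j k)) ⟩
    ∑ R (λ k → δ R j k * E k z)           ≈⟨ ∑-δ j (λ k → E k z) ⟩
    E j z                                 ∎

  subring-∑ : ∀ {k} {K : Pred Carrier k} → IsSubring R K →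
              ∀ {n} (f : Fin n → Carrier) → (∀ j → K (f j)) → K (∑ R f)
  subring-∑ K-subring {zero} f Kf = IsSubring.has-0 K-subring
  subring-∑ K-subring {suc n} f Kf =
    IsSubring.+-closed K-subring (Kf Fin.zero) (subring-∑ K-subring (f ∘ Fin.suc) (Kf ∘ Fin.suc))

  subring-stable : ∀ {N k} {E : Fin N → Carrier → Carrier} {K : Pred Carrier k} → IsSubring R K →
                   (∀ i {x} → K x → K (E i x)) → Stable E K
  subring-stable K-subring E-closed = record
    { respects = IsSubring.resp K-subring
    ; has-0    = IsSubring.has-0 K-subring
    ; +-closed = IsSubring.+-closed K-subring
    ; -‿closed = IsSubring.neg-closed K-subring
    ; E-closed = E-closed
    }

  module Constants {b : Level} (B : Pred Carrier b) (B-subring : IsSubring R B) where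

    B[_] : ∀ {N} → (Fin N → Carrier → Carrier) → Pred Carrier (c ⊔ ℓ ⊔ b)
    B[ E ] = _[_] R B E

    stable⊆B[] : ∀ {N k} {E : Fin N → Carrier → Carrier} {K : Pred Carrier k} →
                 Stable E K → K ⊆ B → K ⊆ B[ E ]
    stable⊆B[] st K⊆B kx = K⊆B kx , (λ F u → K⊆B (𝔘-preserves st u kx))

    B[]-antitone : ∀ {N} {E E' : Fin N → Carrier → Carrier} →
                   (∀ {F} → 𝔘 R E F → 𝔘 R E' F) → B[ E' ] ⊆ B[ E ]
    B[]-antitone 𝔘E⊆𝔘E' (bx , FxB) = bx , (λ F u → FxB F (𝔘E⊆𝔘E' u))

    module SubringOfConstants {N : ℕ} (E : Fin N → Carrier → Carrier)
                              (isE : ∀ i → IsDerivation R (E i)) where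

      -- F ∘ E_i ∈ 𝔘(E) for F ∈ 𝔘(E), so B_E is closed under each E_i.
      E-closed : ∀ i {x} → B[ E ] x → B[ E ] (E i x)
      E-closed i (_ , FxB) = FxB (E i) (gen i) , (λ F u → FxB (F ∘ E i) (comp u (gen i)))

      data Generated : Pred Carrier (c ⊔ ℓ ⊔ b) where
        base     : ∀ {x} → B[ E ] x → Generated x
        respects : ∀ {x y} → x ≈ y → Generated x → Generated y
        has-0    : Generated 0#
        has-1    : Generated 1#
        +-closed : ∀ {x y} → Generated x → Generated y → Generated (x + y)
        -‿closed : ∀ {x} → Generated x → Generated (- x)
        *-closed : ∀ {x y} → Generated x → Generated y → Generated (x * y)

      Generated⊆B : Generated ⊆ B
      Generated⊆B (base (bx , _))   = bx
      Generated⊆B (respects x≈y gx) = IsSubring.resp B-subring x≈y (Generated⊆B gx)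
      Generated⊆B has-0             = IsSubring.has-0 B-subring
      Generated⊆B has-1             = IsSubring.has-1 B-subring
      Generated⊆B (+-closed gx gy)  = IsSubring.+-closed B-subring (Generated⊆B gx) (Generated⊆B gy)
      Generated⊆B (-‿closed gx)     = IsSubring.neg-closed B-subring (Generated⊆B gx)
      Generated⊆B (*-closed gx gy)  = IsSubring.*-closed B-subring (Generated⊆B gx) (Generated⊆B gy)

      generated-subring : IsSubring R Generated
      generated-subring = record
        { resp = respects ; has-0 = has-0 ; has-1 = has-1
        ; +-closed = +-closed ; neg-closed = -‿closed ; *-closed = *-closed }

      Generated-E-closed : ∀ i {x} → Generated x → Generated (E i x)
      Generated-E-closed i = closed
        where
        open IsDerivation (isE i)
        open DerivationFacts (isE i)

        closed : ∀ {x} → Generated x → Generated (E i x)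
        closed (base bx)         = base (E-closed i bx)
        closed (respects x≈y gx) = respects (cong x≈y) (closed gx)
        closed has-0             = respects (sym D-0) has-0
        closed has-1             = respects (sym D-1) has-0
        closed (+-closed gx gy)  = respects (sym (additive _ _)) (+-closed (closed gx) (closed gy))
        closed (-‿closed gx)     = respects (sym (D-neg _)) (-‿closed (closed gx))
        closed (*-closed gx gy)  =
          respects (sym (leibniz _ _)) (+-closed (*-closed gx (closed gy)) (*-closed gy (closed gx)))

      Generated⊆B[E] : Generated ⊆ B[ E ]
      Generated⊆B[E] = stable⊆B[] (subring-stable generated-subring Generated-E-closed) Generated⊆B

      isSubring : IsSubring R B[ E ]
      isSubring = record
        { resp       = λ x≈y → Generated⊆B[E] ∘ respects x≈y ∘ base
        ; has-0      = Generated⊆B[E] has-0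
        ; has-1      = Generated⊆B[E] has-1
        ; +-closed   = λ bx by → Generated⊆B[E] (+-closed (base bx) (base by))
        ; neg-closed = Generated⊆B[E] ∘ -‿closed ∘ base
        ; *-closed   = λ bx by → Generated⊆B[E] (*-closed (base bx) (base by))
        }

    B[]⊆B[transform] : ∀ {N} (E : Fin N → Carrier → Carrier) → (∀ i → IsDerivation R (E i)) →
                       (C : Mat R N) → (∀ i j → B[ E ] (C i j)) → B[ E ] ⊆ B[ transform R C E ]
    B[]⊆B[transform] E isE C C-in = stable⊆B[] (subring-stable isSubring CE-closed) proj₁
      where
      open SubringOfConstants E isE using (isSubring; E-closed)

      CE-closed : ∀ i {x} → B[ E ] x → B[ E ] (transform R C E i x)
      CE-closed i bx = subring-∑ isSubring _ (λ j → IsSubring.*-closed isSubring (C-in i j) (E-closed j bx))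

lemma2p26 : {c ℓ b : Level} (R : CommutativeRing c ℓ) (B : Pred (CommutativeRing.Carrier R) b)
    → IsSubring R B
    → (N : ℕ) (D : Fin N → CommutativeRing.Carrier R → CommutativeRing.Carrier R)
    → (∀ i → IsDerivation R (D i))
    → (C : Mat R N) → InGL R N (_[_] R B D) C
    → (_[_] R B D ⊆ _[_] R B (transform R C D)) × (_[_] R B (transform R C D) ⊆ _[_] R B D)
lemma2p26 R B B-subring N D isD C (C-in , C⁻¹ , C⁻¹-in , _ , C⁻¹C≈I) = forward , backward
  where
  open Development R
  open Constants B B-subring

  CD = transform R C D

  forward : B[ D ] ⊆ B[ CD ]
  forward = B[]⊆B[transform] D isD C C-in

  -- C⁻¹(CD) = D pointwise, so every generator D_j lies in 𝔘(C⁻¹(CD)).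
  𝔘D⊆𝔘C⁻¹CD : ∀ {F} → 𝔘 R D F → 𝔘 R (transform R C⁻¹ CD) F
  𝔘D⊆𝔘C⁻¹CD = 𝔘-mono (λ j → ext (gen j) (transform-inverse C⁻¹ C D C⁻¹C≈I j))

  backward : B[ CD ] ⊆ B[ D ]
  backward = B[]-antitone 𝔘D⊆𝔘C⁻¹CD
           ∘ B[]⊆B[transform] CD (transform-derivation C D isD) C⁻¹ (λ i j → forward (C⁻¹-in i j))
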